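{- Let $A$ be a finite set of agents with $|A|\ge2$. Then for every $a\in A$, $\vdash_{\mathsf{SSL}}\neg S_a\top$.
   Context: The language $\mathcal{L}_{KS}$ over a countable set $\mathsf{Prop}$ of variables and agents $A$ is $\varphi::=p\mid\neg\varphi\mid(\varphi\wedge\varphi)\mid K_a\varphi\mid S_a\varphi$, with $\top$ a propositional tautology abbreviation. The system $\mathsf{SSL}$ has axioms: all propositional tautologies; for each $a\in A$: (K) $K_a(\varphi\to\psi)\to(K_a\varphi\to K_a\psi)$, (T) $K_a\varphi\to\varphi$, (4) $K_a\varphi\to K_aK_a\varphi$, (5) $\neg K_a\varphi\to K_a\neg K_a\varphi$, (S1) $S_a\varphi\to K_a\varphi$, (S4) $S_a\varphi\to K_aS_a\varphi$; and for distinct $a,b\in A$: (S2) $S_a\varphi\to\neg K_b\varphi$. Rules: modus ponens; from $\varphi$ infer $K_a\varphi$; from $\vdash\varphi\leftrightarrow\psi$ infer $\vdash S_a\varphi\leftrightarrow S_a\psi$. -}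

module Defs where

open import Data.Nat using (ℕ; zero)
open import Data.Bool using (Bool; true; false; not; _∧_)
open import Relation.Binary.PropositionalEquality using (_≡_; _≢_)

data Form (Ag : Set) : Set where
  var  : ℕ → Form Ag
  ¬'   : Form Ag → Form Ag
  _∧'_ : Form Ag → Form Ag → Form Ag
  K    : Ag → Form Ag → Form Ag
  S    : Ag → Form Ag → Form Ag

module _ {Ag : Set} where
  _→'_ : Form Ag → Form Ag → Form Ag
  φ →' ψ = ¬' (φ ∧' ¬' ψ)

  _↔'_ : Form Ag → Form Ag → Form Ag
  φ ↔' ψ = (φ →' ψ) ∧' (ψ →' φ)

  ⊤' : Form Ag
  ⊤' = ¬' (var zero ∧' ¬' (var zero))

  -- Propositional valuation: treats variables and modal formulas K_a φ, S_a φ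
  -- as propositional atoms.
  record Valuation : Set where
    field
      vVar : ℕ → Bool
      vK   : Ag → Form Ag → Bool
      vS   : Ag → Form Ag → Bool

  open Valuation

  eval : Valuation → Form Ag → Bool
  eval v (var p)  = vVar v p
  eval v (¬' φ)   = not (eval v φ)
  eval v (φ ∧' ψ) = eval v φ ∧ eval v ψ
  eval v (K a φ)  = vK v a φ
  eval v (S a φ)  = vS v a φ

  Tautology : Form Ag → Set
  Tautology φ = ∀ (v : Valuation) → eval v φ ≡ true

  data ⊢SSL_ : Form Ag → Set where
    taut : ∀ {φ} → Tautology φ → ⊢SSL φ
    axK  : ∀ {a φ ψ} → ⊢SSL (K a (φ →' ψ) →' (K a φ →' K a ψ))
    axT  : ∀ {a φ} → ⊢SSL (K a φ →' φ)
    ax4  : ∀ {a φ} → ⊢SSL (K a φ →' K a (K a φ))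
    ax5  : ∀ {a φ} → ⊢SSL (¬' (K a φ) →' K a (¬' (K a φ)))
    axS1 : ∀ {a φ} → ⊢SSL (S a φ →' K a φ)
    axS4 : ∀ {a φ} → ⊢SSL (S a φ →' K a (S a φ))
    axS2 : ∀ {a b φ} → a ≢ b → ⊢SSL (S a φ →' ¬' (K b φ))
    mp   : ∀ {φ ψ} → ⊢SSL (φ →' ψ) → ⊢SSL φ → ⊢SSL ψ
    nec  : ∀ {a φ} → ⊢SSL φ → ⊢SSL (K a φ)
    reS  : ∀ {a φ ψ} → ⊢SSL (φ ↔' ψ) → ⊢SSL (S a φ ↔' S a ψ)

-- By necessitation every agent knows ⊤; axiom S2 says that if a alone knows ⊤
-- then any other agent b does not, so S_a ⊤ is refuted as soon as a second agent exists.
module Submission where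

open import Defs
open import Data.Nat using (ℕ; suc; _≥_; s≤s; z≤n)
open import Data.Fin using (Fin; zero; suc)
open import Data.Bool using (Bool; true; false; not; _∧_)
open import Data.Product using (∃; _,_)
open import Relation.Binary.PropositionalEquality using (_≡_; refl; _≢_)

module _ {Ag : Set} where

  ⊢⊤' : ⊢SSL_ {Ag} ⊤'
  ⊢⊤' = taut λ v → excluded-middle (eval v (var 0))
    where
    excluded-middle : (x : Bool) → not (x ∧ not x) ≡ true
    excluded-middle false = refl
    excluded-middle true  = refl

  ⊢contraposition : {φ ψ : Form Ag} → ⊢SSL (φ →' ¬' ψ) → ⊢SSL ψ → ⊢SSL (¬' φ)
  ⊢contraposition {φ} {ψ} φ→¬ψ ⊢ψ = mp (mp swap φ→¬ψ) ⊢ψ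
    where
    swap-taut : (x y : Bool) →
      not (not (x ∧ not (not y)) ∧ not (not (y ∧ not (not x)))) ≡ true
    swap-taut false false = refl
    swap-taut false true  = refl
    swap-taut true  false = refl
    swap-taut true  true  = refl

    swap : ⊢SSL ((φ →' ¬' ψ) →' (ψ →' ¬' φ))
    swap = taut λ v → swap-taut (eval v φ) (eval v ψ)

  ⊢¬S⊤-if-distinct : {a b : Ag} → a ≢ b → ⊢SSL (¬' (S a ⊤'))
  ⊢¬S⊤-if-distinct a≢b = ⊢contraposition (axS2 a≢b) (nec ⊢⊤')

other-agent : ∀ {m} (a : Fin (suc (suc m))) → ∃ λ b → a ≢ b
other-agent zero    = suc zero , λ ()
other-agent (suc _) = zero , λ ()

proposition4p9 : (n : ℕ) → n ≥ 2 → (a : Fin n) → ⊢SSL_ {Fin n} (¬' (S a ⊤'))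
proposition4p9 (suc (suc m)) (s≤s (s≤s z≤n)) a with other-agent a
... | _ , a≢b = ⊢¬S⊤-if-distinct a≢b
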